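{- Let $n\ge 3$ and let $\mathbb{D}^{t}_{n}$ be the Prism allied graph. If $M$ is any mixed metric generator of $\mathbb{D}^{t}_{n}$, then $\{s_{i} : 1\le i\le n\}\subseteq M$.
   Context: For an integer $n\ge 3$, the Prism allied graph $\mathbb{D}^{t}_{n}$ has vertex set $\{p_i,q_i,r_i,s_i : 1\le i\le n\}$ ($4n$ vertices) and edge set $\{p_iq_i,\ p_ip_{i+1},\ q_iq_{i+1},\ r_iq_i,\ r_iq_{i+1},\ r_is_i : 1\le i\le n\}$ ($6n$ edges), with indices taken modulo $n$ (so $p_{n+1}=p_1$, $q_{n+1}=q_1$). For a connected graph $H$, $d_H(u,v)$ is the length of a shortest $u$–$v$ path, and for a vertex $x$ and an edge $e=uv$, $d_H(x,e)=\min\{d_H(x,u),d_H(x,v)\}$. A set $M\subseteq V(H)$ is a mixed metric generator of $H$ if for every two distinct elements $y_1,y_2\in V(H)\cup E(H)$ there is a vertex $z\in M$ with $d_H(z,y_1)\ne d_H(z,y_2)$. -}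

module Defs where

open import Data.Nat using (ℕ; zero; suc; _≤_; _%_; _<_)
open import Data.Nat.DivMod using (m%n<n)
open import Data.Fin using (Fin; toℕ; fromℕ<)
open import Data.Product using (_×_; _,_; ∃; Σ)
open import Data.Sum using (_⊎_; inj₁; inj₂)
open import Relation.Binary.PropositionalEquality using (_≡_; _≢_)

next : ∀ {n} → Fin n → Fin n
next {suc m} i = fromℕ< (m%n<n (suc (toℕ i)) (suc m))

data Kind : Set where
  P Q R S : Kind

Vertex : ℕ → Set
Vertex n = Kind × Fin n

data EdgeKind : Set where
  pq pp qq rq rq' rs : EdgeKind

Edge : ℕ → Set
Edge n = EdgeKind × Fin n

ends : ∀ {n} → Edge n → Vertex n × Vertex n
ends (pq  , i) = (P , i) , (Q , i)
ends (pp  , i) = (P , i) , (P , next i)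
ends (qq  , i) = (Q , i) , (Q , next i)
ends (rq  , i) = (R , i) , (Q , i)
ends (rq' , i) = (R , i) , (Q , next i)
ends (rs  , i) = (R , i) , (S , i)

end₁ end₂ : ∀ {n} → Edge n → Vertex n
end₁ e = Data.Product.proj₁ (ends e)
end₂ e = Data.Product.proj₂ (ends e)

Adj : ∀ {n} → Vertex n → Vertex n → Set
Adj {n} u v = Σ (Edge n) λ e → (end₁ e ≡ u × end₂ e ≡ v) ⊎ (end₁ e ≡ v × end₂ e ≡ u)

data Walk {n} : Vertex n → Vertex n → ℕ → Set where
  here : ∀ {u} → Walk u u zero
  step : ∀ {u v w k} → Adj u v → Walk v w k → Walk u w (suc k)

Dist : ∀ {n} → Vertex n → Vertex n → ℕ → Set
Dist u v d = Walk u v d × (∀ k → Walk u v k → d ≤ k)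

Min : ℕ → ℕ → ℕ → Set
Min a b d = (d ≡ a × a ≤ b) ⊎ (d ≡ b × b ≤ a)

Element : ℕ → Set
Element n = Vertex n ⊎ Edge n

DistEl : ∀ {n} → Vertex n → Element n → ℕ → Set
DistEl x (inj₁ v) d = Dist x v d
DistEl x (inj₂ e) d = ∃ λ a → ∃ λ b → Dist x (end₁ e) a × Dist x (end₂ e) b × Min a b d

MixedMetricGenerator : ∀ n → (Vertex n → Set) → Set
MixedMetricGenerator n M =
  (y₁ y₂ : Element n) → y₁ ≢ y₂ →
  ∃ λ z → M z × ∃ λ d₁ → ∃ λ d₂ → DistEl z y₁ d₁ × DistEl z y₂ d₂ × d₁ ≢ d₂

{-# OPTIONS --safe #-}
module Submission where

open import Defs
open import Data.Nat using (ℕ; _≤_; suc)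
open import Data.Nat.Properties using (≤-antisym; ≤-trans; n≤1+n)
open import Data.Fin using (Fin)
open import Data.Product using (_,_)
open import Data.Sum using (inj₁; inj₂)
open import Data.Empty using (⊥-elim)
open import Relation.Binary.PropositionalEquality using (_≡_; _≢_; refl; sym; trans; subst)

-- s_i is a pendant vertex, so a vertex z distinguishes r_i from the edge r_i s_i
-- only if z = s_i: for z ≠ s_i every shortest z–s_i path ends with r_i s_i, hence
-- d(z, r_i s_i) = min (d(z, r_i), d(z, r_i) + 1) = d(z, r_i).

Adj-S⇒R : ∀ {n} {u : Vertex n} {i : Fin n} → Adj u (S , i) → u ≡ (R , i)
Adj-S⇒R ((rs  , _) , inj₁ (refl , refl)) = refl
Adj-S⇒R ((rs  , _) , inj₂ (() , _))
Adj-S⇒R ((pq  , _) , inj₁ (_ , ()))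
Adj-S⇒R ((pq  , _) , inj₂ (() , _))
Adj-S⇒R ((pp  , _) , inj₁ (_ , ()))
Adj-S⇒R ((pp  , _) , inj₂ (() , _))
Adj-S⇒R ((qq  , _) , inj₁ (_ , ()))
Adj-S⇒R ((qq  , _) , inj₂ (() , _))
Adj-S⇒R ((rq  , _) , inj₁ (_ , ()))
Adj-S⇒R ((rq  , _) , inj₂ (() , _))
Adj-S⇒R ((rq' , _) , inj₁ (_ , ()))
Adj-S⇒R ((rq' , _) , inj₂ (() , _))

Walk-S⇒Walk-R : ∀ {n} {u : Vertex n} {i : Fin n} {k} →
  Walk u (S , i) (suc k) → Walk u (R , i) k
Walk-S⇒Walk-R (step a here) = subst (λ v → Walk v _ 0) (sym (Adj-S⇒R a)) here
Walk-S⇒Walk-R (step a w@(step _ _)) = step a (Walk-S⇒Walk-R w)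

Dist-unique : ∀ {n} {u v : Vertex n} {a b} → Dist u v a → Dist u v b → a ≡ b
Dist-unique (wa , mina) (wb , minb) = ≤-antisym (mina _ wb) (minb _ wa)

Min-of-≤ : ∀ {a b d} → a ≤ b → Min a b d → d ≡ a
Min-of-≤ _   (inj₁ (d≡a , _))   = d≡a
Min-of-≤ a≤b (inj₂ (d≡b , b≤a)) = trans d≡b (≤-antisym b≤a a≤b)

pendant-edge-resolved-only-by-S : ∀ {n} {z : Vertex n} {i : Fin n} {d₁ d₂} →
  DistEl z (inj₁ (R , i)) d₁ → DistEl z (inj₂ (rs , i)) d₂ → d₁ ≢ d₂ → z ≡ (S , i)
pendant-edge-resolved-only-by-S _ (_ , _ , _ , (here , _) , _) _ = refl
pendant-edge-resolved-only-by-S dr (a , suc m , (wa , mina) , (w , _) , min) d₁≢d₂ =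
  ⊥-elim (d₁≢d₂ (trans (Dist-unique dr (wa , mina)) (sym (Min-of-≤ a≤1+m min))))
  where
  a≤1+m : a ≤ suc m
  a≤1+m = ≤-trans (mina m (Walk-S⇒Walk-R w)) (n≤1+n m)

lemma1 : (n : ℕ) → 3 ≤ n → (M : Vertex n → Set) → MixedMetricGenerator n M →
    (i : Fin n) → M (S , i)
lemma1 n _ M generator i with generator (inj₁ (R , i)) (inj₂ (rs , i)) (λ ())
... | z , Mz , _ , _ , dr , drs , d₁≢d₂ =
  subst M (pendant-edge-resolved-only-by-S dr drs d₁≢d₂) Mz
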